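{- Let $n, m$ be positive integers such that the player can win the rotating-table game with parameters $(n,m)$. Then every finite sequence of moves that guarantees a win has length at least $m^n - 1$.
   Context: The rotating-table game with parameters $(n,m)$: $n$ counters lie on the vertices (positions $1,\dots,n$, fixed from the player's perspective) of a regular $n$-gon table, each showing an element of $\mathbb{Z}_m$; the initial configuration in $\mathbb{Z}_m^n$ is arbitrary and unknown to the blindfolded player, who receives no information. Each turn the player makes a move $y \in \mathbb{Z}_m^n$, adding $y_i$ to the counter at position $i$; then the table is rotated by an arbitrary (adversarially chosen) rotation, i.e. the counters are cyclically shifted by any amount (possibly zero). A strategy is a fixed finite sequence of moves. A sequence of moves "guarantees a win" if for every initial configuration and every choice of rotations, at some point (initially or after some move) all counters simultaneously show $0$; the player "can win" if such a finite sequence exists. -}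

module Defs where

open import Data.Nat using (ℕ; zero; suc; NonZero; _%_)
import Data.Nat as ℕ
open import Data.Nat.DivMod using (m%n<n)
open import Data.Fin using (Fin; toℕ; fromℕ<)
open import Data.List using (List; []; _∷_)
open import Data.List.Relation.Unary.Any using (Any)
open import Data.Product using (∃)
open import Relation.Binary.PropositionalEquality using (_≡_)

_⊕_ : ∀ {k} .{{_ : NonZero k}} → Fin k → Fin k → Fin k
_⊕_ {k} a b = fromℕ< (m%n<n (toℕ a ℕ.+ toℕ b) k)

Config : ℕ → ℕ → Set
Config n m = Fin n → Fin m

applyMove : ∀ {n m} .{{_ : NonZero m}} → Config n m → Config n m → Config n m
applyMove c y i = c i ⊕ y i

rotate : ∀ {n m} .{{_ : NonZero n}} → Fin n → Config n m → Config n m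
rotate r c i = c (i ⊕ r)

AllZero : ∀ {n m} → Config n m → Set
AllZero c = ∀ i → toℕ (c i) ≡ 0

-- The list of configurations seen during play: the initial one, then the
-- one after each move (move applied, then the table rotated by the
-- adversary's chosen rotation rs j for the j-th move).
plays : ∀ {n m} .{{_ : NonZero n}} .{{_ : NonZero m}} →
        Config n m → (ℕ → Fin n) → List (Config n m) → List (Config n m)
plays c rs []       = c ∷ []
plays c rs (y ∷ ys) = c ∷ plays (rotate (rs zero) (applyMove c y)) (λ j → rs (suc j)) ys

GuaranteesWin : ∀ n m .{{_ : NonZero n}} .{{_ : NonZero m}} → List (Config n m) → Set
GuaranteesWin n m ys = ∀ (c : Config n m) (rs : ℕ → Fin n) → Any AllZero (plays c rs ys)

CanWin : ∀ n m .{{_ : NonZero n}} .{{_ : NonZero m}} → Set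
CanWin n m = ∃ λ (ys : List (Config n m)) → GuaranteesWin n m ys

{-# OPTIONS --safe #-}
module Submission where

-- Against the adversary who never rotates the table, the configuration after j moves is the
-- initial one plus the first j moves, so the first moment at which all counters read 0
-- determines the initial configuration. A winning sequence of length ℓ therefore embeds the
-- m ^ n initial configurations into the ℓ + 1 moments of play.

open import Defs
open import Data.Nat using (ℕ; NonZero; _^_; _∸_; _≤_; _<_; _+_; _%_; suc)
open import Data.Nat.Properties using (+-assoc; +-identityʳ; m+[n∸m]≡n; <⇒≤; ∸-monoˡ-≤)
open import Data.Nat.DivMod using (m%n<n; m<n⇒m%n≡m; [m+n]%n≡m%n; %-distribˡ-+)
open import Data.Fin using (Fin; toℕ; zero; suc; funToFin; finToFun; combine)
open import Data.Fin.Properties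
  using (toℕ<n; toℕ-fromℕ<; toℕ-injective; suc-injective; injective⇒≤; funToFin-finToFin)
open import Data.List using (List; []; _∷_; length)
open import Data.List.Relation.Unary.Any using (Any; here; there)
open import Function using (_∘_)
open import Relation.Binary.PropositionalEquality
  using (_≡_; refl; sym; trans; cong; cong₂; _≗_; module ≡-Reasoning)

[m+n+[k∸n]]%k≡m : ∀ {m n k} .{{_ : NonZero k}} → m < k → n ≤ k → (m + n + (k ∸ n)) % k ≡ m
[m+n+[k∸n]]%k≡m {m} {n} {k} m<k n≤k = begin
  (m + n + (k ∸ n)) % k  ≡⟨ cong (_% k) (+-assoc m n (k ∸ n)) ⟩
  (m + (n + (k ∸ n))) % k ≡⟨ cong (λ t → (m + t) % k) (m+[n∸m]≡n n≤k) ⟩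
  (m + k) % k            ≡⟨ [m+n]%n≡m%n m k ⟩
  m % k                  ≡⟨ m<n⇒m%n≡m m<k ⟩
  m                      ∎
  where open ≡-Reasoning

+-%-cancelʳ : ∀ {m m′ n k} .{{_ : NonZero k}} → m < k → m′ < k → n ≤ k →
              (m + n) % k ≡ (m′ + n) % k → m ≡ m′
+-%-cancelʳ {m} {m′} {n} {k} m<k m′<k n≤k eq = begin
  m                                    ≡⟨ sym ([m+n+[k∸n]]%k≡m m<k n≤k) ⟩
  (m + n + (k ∸ n)) % k                ≡⟨ %-distribˡ-+ (m + n) (k ∸ n) k ⟩
  ((m + n) % k + (k ∸ n) % k) % k      ≡⟨ cong (λ t → (t + (k ∸ n) % k) % k) eq ⟩
  ((m′ + n) % k + (k ∸ n) % k) % k     ≡⟨ sym (%-distribˡ-+ (m′ + n) (k ∸ n) k) ⟩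
  (m′ + n + (k ∸ n)) % k               ≡⟨ [m+n+[k∸n]]%k≡m m′<k n≤k ⟩
  m′                                   ∎
  where open ≡-Reasoning

toℕ-⊕ : ∀ {k} .{{_ : NonZero k}} (a b : Fin k) → toℕ (a ⊕ b) ≡ (toℕ a + toℕ b) % k
toℕ-⊕ {k} a b = toℕ-fromℕ< (m%n<n (toℕ a + toℕ b) k)

⊕-cancelʳ : ∀ {k} .{{_ : NonZero k}} (a a′ b : Fin k) → a ⊕ b ≡ a′ ⊕ b → a ≡ a′
⊕-cancelʳ a a′ b eq = toℕ-injective
  (+-%-cancelʳ (toℕ<n a) (toℕ<n a′) (<⇒≤ (toℕ<n b))
    (trans (sym (toℕ-⊕ a b)) (trans (cong toℕ eq) (toℕ-⊕ a′ b))))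

⊕-identityʳ : ∀ {k} (i : Fin (suc k)) → i ⊕ zero ≡ i
⊕-identityʳ {k} i = toℕ-injective (begin
  toℕ (i ⊕ zero)       ≡⟨ toℕ-⊕ i zero ⟩
  (toℕ i + 0) % suc k  ≡⟨ cong (_% suc k) (+-identityʳ (toℕ i)) ⟩
  toℕ i % suc k        ≡⟨ m<n⇒m%n≡m (toℕ<n i) ⟩
  toℕ i                ∎)
  where open ≡-Reasoning

AllZero-unique : ∀ {n m} {c d : Config n m} → AllZero c → AllZero d → c ≗ d
AllZero-unique c≡0 d≡0 i = toℕ-injective (trans (c≡0 i) (sym (d≡0 i)))

applyMove-cancelʳ : ∀ {n m} .{{_ : NonZero m}} {c d : Config n m} (y : Config n m) →
                    applyMove c y ≗ applyMove d y → c ≗ d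
applyMove-cancelʳ {c = c} {d} y eq i = ⊕-cancelʳ (c i) (d i) (y i) (eq i)

rotate-zero : ∀ {k m} (c : Config (suc k) m) → rotate zero c ≗ c
rotate-zero c i = cong c (⊕-identityʳ i)

funToFin-cong : ∀ {n m} {f g : Fin n → Fin m} → f ≗ g → funToFin f ≡ funToFin g
funToFin-cong {ℕ.zero} f≗g = refl
funToFin-cong {suc n}  f≗g = cong₂ combine (f≗g zero) (funToFin-cong (f≗g ∘ suc))

Config-injective⇒≤ : ∀ {n m r} (F : Config n m → Fin r) →
                     (∀ c d → F c ≡ F d → c ≗ d) → m ^ n ≤ r
Config-injective⇒≤ {n} {m} F F-inj = injective⇒≤ {f = F ∘ finToFun} λ {a} {b} eq → begin
  a                         ≡⟨ sym (funToFin-finToFin {n} {m} a) ⟩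
  funToFin {n} (finToFun a) ≡⟨ funToFin-cong (F-inj (finToFun a) (finToFun b) eq) ⟩
  funToFin {n} (finToFun b) ≡⟨ funToFin-finToFin {n} {m} b ⟩
  b                         ∎
  where open ≡-Reasoning

module _ {k m : ℕ} .{{_ : NonZero m}} where

  winningTime : ∀ (c : Config (suc k) m) rs ys →
                Any AllZero (plays c rs ys) → Fin (suc (length ys))
  winningTime c rs []       (here _)  = zero
  winningTime c rs (y ∷ ys) (here _)  = zero
  winningTime c rs (y ∷ ys) (there p) = suc (winningTime _ (rs ∘ suc) ys p)

  noRotation : ℕ → Fin (suc k)
  noRotation _ = zero

  winningTime-noRotation-injective :
    ∀ (c d : Config (suc k) m) ys
      (p : Any AllZero (plays c noRotation ys)) (q : Any AllZero (plays d noRotation ys)) →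
    winningTime c noRotation ys p ≡ winningTime d noRotation ys q → c ≗ d
  winningTime-noRotation-injective c d []       (here c≡0) (here d≡0) _  = AllZero-unique c≡0 d≡0
  winningTime-noRotation-injective c d (y ∷ ys) (here c≡0) (here d≡0) _  = AllZero-unique c≡0 d≡0
  winningTime-noRotation-injective c d (y ∷ ys) (there p)  (there q)  eq =
    applyMove-cancelʳ y λ i → begin
      applyMove c y i               ≡⟨ sym (rotate-zero (applyMove c y) i) ⟩
      rotate zero (applyMove c y) i ≡⟨ next≗ i ⟩
      rotate zero (applyMove d y) i ≡⟨ rotate-zero (applyMove d y) i ⟩
      applyMove d y i               ∎
    where
    open ≡-Reasoning
    next≗ : rotate zero (applyMove c y) ≗ rotate zero (applyMove d y)
    next≗ = winningTime-noRotation-injective _ _ ys p q (suc-injective eq)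

theorem5p1 : ∀ (n m : ℕ) .{{_ : NonZero n}} .{{_ : NonZero m}} →
    CanWin n m → (ys : List (Config n m)) → GuaranteesWin n m ys →
    m ^ n ∸ 1 ≤ length ys
theorem5p1 (suc k) m _ ys wins = ∸-monoˡ-≤ 1 (Config-injective⇒≤ firstWin firstWin-injective)
  where
  firstWin : Config (suc k) m → Fin (suc (length ys))
  firstWin c = winningTime c noRotation ys (wins c noRotation)

  firstWin-injective : ∀ c d → firstWin c ≡ firstWin d → c ≗ d
  firstWin-injective c d = winningTime-noRotation-injective c d ys _ _
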